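{- Let $M$ be a matroid, let $S,T$ be disjoint subsets of $E(M)$, let $k := \kappa_M(S,T)$, and let $F\subseteq E(M)- (S\cup T)$ be a set of elements none of which is flexible with respect to $(S,T)$. Then there exist an ordering $(f_1, f_2, \ldots, f_t)$ of $F$ and a sequence $(A_1, A_2, \ldots, A_t)$ of subsets of $E(M)$ such that (1) $A_i$ is $S$-$T$-separating of order $k+1$ for each $i \in \{1,\ldots,t\}$; (2) $A_{i} \subseteq A_{i+1}$ for each $i\in \{1,\ldots, t-1\}$; (3) $A_i \cap F = \{f_1, \dots, f_i\}$ for each $i \in \{1,\ldots,t\}$; (4) for each $i$, $f_i \in \mathrm{cl}_M(A_i- f_i) \cap \mathrm{cl}_M(E(M)- A_i)$ or $f_i \in \mathrm{cl}^*_M(A_i- f_i) \cap \mathrm{cl}^*_M(E(M)- A_i)$.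
   Context: For a matroid $M$ with ground set $E$, $\lambda_M(X) := r_M(X) + r_M(E- X) - r(M)$, and for disjoint $S,T\subseteq E$, $\kappa_M(S,T) := \min\{\lambda_M(X) : S \subseteq X \subseteq E- T\}$. A set $A\subseteq E(M)$ is $S$-$T$-separating of order $k+1$ if $S\subseteq A$, $T\subseteq E(M)-A$ and $\lambda_M(A)=k$. $\mathrm{cl}_M$ and $\mathrm{cl}^*_M$ denote closure and coclosure. An element $e\in E(M)-(S\cup T)$ is deletable (w.r.t. $(S,T)$) if $\kappa_{M\setminus e}(S,T)=\kappa_M(S,T)$, contractible if $\kappa_{M/ e}(S,T)=\kappa_M(S,T)$, and flexible if it is both deletable and contractible. -}

module Defs where

open import Data.Nat using (ℕ; _+_; _∸_; _≤_; _⊓_)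
open import Data.Fin using (Fin)
open import Data.Fin.Subset using (Subset; _∈_; _⊆_; _∪_; _∩_; _─_; _-_; ∁; ⁅_⁆; ∣_∣; Empty; inside; outside)
open import Data.Fin.Subset.Properties using (_⊆?_)
open import Data.List using (List; []; _∷_; map; _++_; foldr; filter)
open import Data.Vec using (_∷_; [])
open import Data.Product using (_×_)
open import Relation.Nullary using (¬_; Dec; yes; no)
open import Relation.Nullary.Decidable using (_×-dec_)
open import Relation.Binary.PropositionalEquality using (_≡_)

-- Matroid data on a ground set E ⊆ Fin n, given by its rank function.
-- (The rank function is only meaningful on subsets of E.)
record MatroidData (n : ℕ) : Set where
  constructor mkMatroid
  field
    E  : Subset n
    rk : Subset n → ℕ
open MatroidData public

record IsMatroid {n : ℕ} (M : MatroidData n) : Set where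
  field
    R1 : ∀ X → X ⊆ E M → rk M X ≤ ∣ X ∣
    R2 : ∀ X Y → X ⊆ Y → Y ⊆ E M → rk M X ≤ rk M Y
    R3 : ∀ X Y → X ⊆ E M → Y ⊆ E M →
         rk M (X ∪ Y) + rk M (X ∩ Y) ≤ rk M X + rk M Y

delete : ∀ {n} → MatroidData n → Fin n → MatroidData n
delete M e = mkMatroid (E M - e) (rk M)

contract : ∀ {n} → MatroidData n → Fin n → MatroidData n
contract M e = mkMatroid (E M - e) (λ X → rk M (X ∪ ⁅ e ⁆) ∸ rk M ⁅ e ⁆)

dual : ∀ {n} → MatroidData n → MatroidData n
dual M = mkMatroid (E M) (λ X → ∣ X ∣ + rk M (E M ─ X) ∸ rk M (E M))

conn : ∀ {n} → MatroidData n → Subset n → ℕ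
conn M X = rk M X + rk M (E M ─ X) ∸ rk M (E M)

allSubsets : (n : ℕ) → List (Subset n)
allSubsets ℕ.zero = [] ∷ []
allSubsets (ℕ.suc n) = map (inside ∷_) (allSubsets n) ++ map (outside ∷_) (allSubsets n)

minimumWith : ℕ → List ℕ → ℕ
minimumWith d [] = d
minimumWith d (x ∷ xs) = foldr _⊓_ x xs

-- κ_M(S,T) = min { λ_M(X) : S ⊆ X ⊆ E - T }.
-- (The range is nonempty whenever S ⊆ E and S ∩ T = ∅, since X = S qualifies.)
kappa : ∀ {n} → MatroidData n → Subset n → Subset n → ℕ
kappa {n} M S T =
  minimumWith (conn M S)
    (map (conn M) (filter (λ X → (S ⊆? X) ×-dec (X ⊆? (E M ─ T))) (allSubsets n)))

Deletable : ∀ {n} → MatroidData n → Subset n → Subset n → Fin n → Set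
Deletable M S T e = kappa (delete M e) S T ≡ kappa M S T

Contractible : ∀ {n} → MatroidData n → Subset n → Subset n → Fin n → Set
Contractible M S T e = kappa (contract M e) S T ≡ kappa M S T

Flexible : ∀ {n} → MatroidData n → Subset n → Subset n → Fin n → Set
Flexible M S T e = e ∈ (E M ─ (S ∪ T)) × Deletable M S T e × Contractible M S T e

InCl : ∀ {n} → MatroidData n → Subset n → Fin n → Set
InCl M X e = e ∈ E M × rk M (X ∪ ⁅ e ⁆) ≡ rk M X

InCoCl : ∀ {n} → MatroidData n → Subset n → Fin n → Set
InCoCl M X e = InCl (dual M) X e

-- A is S-T-separating of order k+1.
STSeparating : ∀ {n} → MatroidData n → Subset n → Subset n → ℕ → Subset n → Set
STSeparating M S T k A = A ⊆ E M × S ⊆ A × T ⊆ (E M ─ A) × conn M A ≡ k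

-- If e is not flexible, then κ drops in M \ e or in M / e, and a set realising the smaller value
-- of κ gives separations W - e ⊂ W of M, both of order κ + 1. By submodularity of λ these
-- separations are closed under union and intersection, so each f ∈ F lies in a least one, D(f),
-- and D(f) - f is again one. Hence f ∈ D(g) with f ≠ g forces D(f) ⊊ D(g). Listing F by
-- increasing |D(f)| and taking A_i = D(f_1) ∪ ⋯ ∪ D(f_i) gives the chain; finally
-- λ(A_i - f_i) = λ(A_i) puts f_i in the closure of both sides or in the coclosure of both.
module Submission where

open import Defs
open import Data.Fin using (Fin; toℕ)
import Data.Fin as Fin
open import Data.Fin.Properties using (toℕ-injective)
open import Data.Fin.Subset
open import Data.Fin.Subset.Properties
open import Data.List using (List; []; _∷_; foldr; map; filter; allFin)
open import Data.List.Extrema.Nat using (argmin; argmin-all; f[argmin]≤v⁺)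
open import Data.List.Membership.Propositional using (lose; find) renaming (_∈_ to _∈ₗ_)
open import Data.List.Membership.Propositional.Properties
  using (∈-filter⁺; ∈-filter⁻; ∈-allFin; ∈-map⁺; ∈-map⁻; ∈-++⁺ˡ; ∈-++⁺ʳ; foldr-selective)
open import Data.List.Properties using (foldr-preservesᵒ)
open import Data.List.Relation.Unary.All as All using (All; []; _∷_)
open import Data.List.Relation.Unary.All.Properties using (all-filter) renaming (map⁺ to All-map⁺)
open import Data.List.Relation.Unary.Any as Any using (Any)
open import Data.List.Relation.Unary.Any.Properties using () renaming (map⁺ to Any-map⁺; map⁻ to Any-map⁻)
open import Data.Nat using (ℕ; zero; suc; _+_; _∸_; _≤_; _<_; z≤n; s≤s)
open import Data.Nat.Properties
open import Algebra.Properties.CommutativeSemigroup +-commutativeSemigroup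
  using (interchange; xy∙z≈xz∙y)
open import Data.Product using (_×_; Σ; ∃-syntax; _,_; proj₁; proj₂)
open import Data.Sum using (_⊎_; inj₁; inj₂; [_,_]′)
open import Data.Vec using (_∷_; []; here; there)
open import Function using (_∘_)
open import Function.Bundles using (_⇔_; mk⇔; Equivalence)
open import Function.Definitions using (Injective)
open import Relation.Binary.PropositionalEquality
open import Relation.Nullary using (¬_; Dec; yes; no; contradiction)
open import Relation.Nullary.Decidable using (_×-dec_)

m+q≤o+n⇒m∸n≤o∸q : ∀ m n o q → m + q ≤ o + n → m ∸ n ≤ o ∸ q
m+q≤o+n⇒m∸n≤o∸q m n o q m+q≤o+n with q ≤? o
... | yes q≤o = m≤n+o⇒m∸n≤o m n (begin
  m            ≤⟨ m+n≤o⇒m≤o∸n m m+q≤o+n ⟩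
  o + n ∸ q    ≡⟨ cong (_∸ q) (+-comm o n) ⟩
  n + o ∸ q    ≡⟨ +-∸-assoc n q≤o ⟩
  n + (o ∸ q)  ∎)
  where open ≤-Reasoning
... | no q≰o = subst (_≤ o ∸ q) (sym (m≤n⇒m∸n≡0 m≤n)) z≤n
  where
  m≤n : m ≤ n
  m≤n = +-cancelʳ-≤ q m n (≤-trans m+q≤o+n
          (≤-trans (+-monoˡ-≤ n (<⇒≤ (≰⇒> q≰o))) (≤-reflexive (+-comm q n))))

m+q≤1+o+n⇒m∸n≤1+o∸q : ∀ m n o q → m + q ≤ suc (o + n) → m ∸ n ≤ suc (o ∸ q)
m+q≤1+o+n⇒m∸n≤1+o∸q m n o q le = ≤-trans (m+q≤o+n⇒m∸n≤o∸q m n (suc o) q le)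
  (m≤n+o⇒m∸n≤o (suc o) q (≤-trans (s≤s (m≤n+m∸n o q)) (≤-reflexive (sym (+-suc q (o ∸ q))))))

+-squeeze : ∀ {m n o} → m + n ≤ o + o → o ≤ m → o ≤ n → m ≡ o × n ≡ o
+-squeeze {m} {n} {o} m+n≤o+o o≤m o≤n =
  ≤-antisym (+-cancelʳ-≤ o m o (≤-trans (+-monoʳ-≤ m o≤n) m+n≤o+o)) o≤m ,
  ≤-antisym (+-cancelˡ-≤ o n o (≤-trans (+-monoˡ-≤ n o≤m) m+n≤o+o)) o≤n

[m∸o]+[n∸o]∸[p∸o]≡[m+n]∸[p+o] : ∀ {m n p o} → o ≤ m → o ≤ n → o ≤ p →
  (m ∸ o) + (n ∸ o) ∸ (p ∸ o) ≡ m + n ∸ (p + o)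
[m∸o]+[n∸o]∸[p∸o]≡[m+n]∸[p+o] {m} {n} {p} {o} o≤m o≤n o≤p = begin
  (m ∸ o) + (n ∸ o) ∸ (p ∸ o)
    ≡⟨ [m+n]∸[m+o]≡n∸o (o + o) _ (p ∸ o) ⟨
  (o + o) + ((m ∸ o) + (n ∸ o)) ∸ ((o + o) + (p ∸ o))
    ≡⟨ cong₂ _∸_ (trans (+-comm (o + o) _) (interchange (m ∸ o) (n ∸ o) o o))
                 (trans (+-comm (o + o) (p ∸ o)) (sym (+-assoc (p ∸ o) o o))) ⟩
  ((m ∸ o) + o) + ((n ∸ o) + o) ∸ ((p ∸ o) + o + o)
    ≡⟨ cong₂ _∸_ (cong₂ _+_ (m∸n+n≡m o≤m) (m∸n+n≡m o≤n)) (cong (_+ o) (m∸n+n≡m o≤p)) ⟩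
  m + n ∸ (p + o)                                  ∎
  where open ≡-Reasoning

private
  variable
    n : ℕ
    p q t : Subset n
    x y : Fin n

x∈p─q⁻ : x ∈ p ─ q → x ∈ p × x ∉ q
x∈p─q⁻ {p = inside ∷ p} {q = outside ∷ q} here = here , λ ()
x∈p─q⁻ {x = Fin.zero} {p = _ ∷ p} {q = inside ∷ q} ()
x∈p─q⁻ {x = Fin.zero} {p = outside ∷ p} {q = outside ∷ q} ()
x∈p─q⁻ {p = _ ∷ p} {q = _ ∷ q} (there x∈p─q) =
  let x∈p , x∉q = x∈p─q⁻ x∈p─q in there x∈p , x∉q ∘ drop-there

x∈p-y⁻ : x ∈ p - y → x ∈ p × x ≢ y
x∈p-y⁻ x∈p-y = let x∈p , x∉⁅y⁆ = x∈p─q⁻ x∈p-y in x∈p , x∉⁅y⁆⇒x≢y x∉⁅y⁆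

∪-lub : p ⊆ t → q ⊆ t → p ∪ q ⊆ t
∪-lub {p = p} {q = q} p⊆t q⊆t x∈p∪q = [ p⊆t , q⊆t ]′ (x∈p∪q⁻ p q x∈p∪q)

⁅x⁆⊆p : x ∈ p → ⁅ x ⁆ ⊆ p
⁅x⁆⊆p {p = p} x∈p y∈⁅x⁆ = subst (_∈ p) (sym (x∈⁅y⁆⇒x≡y _ y∈⁅x⁆)) x∈p

p─[q∩r]≡[p─q]∪[p─r] : ∀ (p q r : Subset n) → p ─ (q ∩ r) ≡ (p ─ q) ∪ (p ─ r)
p─[q∩r]≡[p─q]∪[p─r] [] [] [] = refl
p─[q∩r]≡[p─q]∪[p─r] (s ∷ p) (inside ∷ q) (inside ∷ r) = cong (outside ∷_) (p─[q∩r]≡[p─q]∪[p─r] p q r)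
p─[q∩r]≡[p─q]∪[p─r] (s ∷ p) (inside ∷ q) (outside ∷ r) = cong (s ∷_) (p─[q∩r]≡[p─q]∪[p─r] p q r)
p─[q∩r]≡[p─q]∪[p─r] (inside ∷ p) (outside ∷ q) (_ ∷ r) = cong (inside ∷_) (p─[q∩r]≡[p─q]∪[p─r] p q r)
p─[q∩r]≡[p─q]∪[p─r] (outside ∷ p) (outside ∷ q) (inside ∷ r) = cong (outside ∷_) (p─[q∩r]≡[p─q]∪[p─r] p q r)
p─[q∩r]≡[p─q]∪[p─r] (outside ∷ p) (outside ∷ q) (outside ∷ r) = cong (outside ∷_) (p─[q∩r]≡[p─q]∪[p─r] p q r)

p─[q∪r]≡[p─q]∩[p─r] : ∀ (p q r : Subset n) → p ─ (q ∪ r) ≡ (p ─ q) ∩ (p ─ r)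
p─[q∪r]≡[p─q]∩[p─r] [] [] [] = refl
p─[q∪r]≡[p─q]∩[p─r] (s ∷ p) (inside ∷ q) (_ ∷ r) = cong (outside ∷_) (p─[q∪r]≡[p─q]∩[p─r] p q r)
p─[q∪r]≡[p─q]∩[p─r] (inside ∷ p) (outside ∷ q) (inside ∷ r) = cong (outside ∷_) (p─[q∪r]≡[p─q]∩[p─r] p q r)
p─[q∪r]≡[p─q]∩[p─r] (outside ∷ p) (outside ∷ q) (inside ∷ r) = cong (outside ∷_) (p─[q∪r]≡[p─q]∩[p─r] p q r)
p─[q∪r]≡[p─q]∩[p─r] (inside ∷ p) (outside ∷ q) (outside ∷ r) = cong (inside ∷_) (p─[q∪r]≡[p─q]∩[p─r] p q r)
p─[q∪r]≡[p─q]∩[p─r] (outside ∷ p) (outside ∷ q) (outside ∷ r) = cong (outside ∷_) (p─[q∪r]≡[p─q]∩[p─r] p q r)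

[p∪q]─r≡[p─r]∪[q─r] : ∀ (p q r : Subset n) → (p ∪ q) ─ r ≡ (p ─ r) ∪ (q ─ r)
[p∪q]─r≡[p─r]∪[q─r] [] [] [] = refl
[p∪q]─r≡[p─r]∪[q─r] (_ ∷ p) (_ ∷ q) (inside ∷ r) = cong (outside ∷_) ([p∪q]─r≡[p─r]∪[q─r] p q r)
[p∪q]─r≡[p─r]∪[q─r] (_ ∷ p) (_ ∷ q) (outside ∷ r) = cong (_ ∷_) ([p∪q]─r≡[p─r]∪[q─r] p q r)

⊥─p≡⊥ : ∀ (p : Subset n) → ⊥ ─ p ≡ ⊥
⊥─p≡⊥ [] = refl
⊥─p≡⊥ (inside ∷ p) = cong (outside ∷_) (⊥─p≡⊥ p)
⊥─p≡⊥ (outside ∷ p) = cong (outside ∷_) (⊥─p≡⊥ p)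

p─[q∪⁅x⁆]≡p-x─q : ∀ (p q : Subset n) x → p ─ (q ∪ ⁅ x ⁆) ≡ p - x ─ q
p─[q∪⁅x⁆]≡p-x─q p q x = trans (sym (p─q─r≡p─q∪r p q ⁅ x ⁆)) (p─q─r≡p─r─q p q ⁅ x ⁆)

x∉p⇒p-x≡p : x ∉ p → p - x ≡ p
x∉p⇒p-x≡p {x = x} {p = p} x∉p = ⊆-antisym (p─q⊆p p ⁅ x ⁆)
  (λ {y} y∈p → x∈p∧x≢y⇒x∈p-y y∈p λ { refl → x∉p y∈p })

x∈p⇒p-x∪⁅x⁆≡p : x ∈ p → (p - x) ∪ ⁅ x ⁆ ≡ p
x∈p⇒p-x∪⁅x⁆≡p {x = x} {p = p} x∈p = ⊆-antisym
  (∪-lub (p─q⊆p p ⁅ x ⁆) (⁅x⁆⊆p x∈p))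
  (λ {y} y∈p → x∈p∪q⁺ (case-≟ y y∈p))
  where
  case-≟ : ∀ y → y ∈ p → y ∈ p - x ⊎ y ∈ ⁅ x ⁆
  case-≟ y y∈p with y Fin.≟ x
  ... | yes refl = inj₂ (x∈⁅x⁆ x)
  ... | no y≢x = inj₁ (x∈p∧x≢y⇒x∈p-y y∈p y≢x)

p⊆q⇒p∪[q─p]≡q : p ⊆ q → p ∪ (q ─ p) ≡ q
p⊆q⇒p∪[q─p]≡q {p = p} {q = q} p⊆q = ⊆-antisym (∪-lub p⊆q (p─q⊆p q p)) q⊆p∪[q─p]
  where
  q⊆p∪[q─p] : q ⊆ p ∪ (q ─ p)
  q⊆p∪[q─p] {x} x∈q with x ∈? p
  ... | yes x∈p = x∈p∪q⁺ (inj₁ x∈p)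
  ... | no x∉p = x∈p∪q⁺ (inj₂ (x∈p∧x∉q⇒x∈p─q x∈q x∉p))

p⊆q⇒q─[q─p]≡p : p ⊆ q → q ─ (q ─ p) ≡ p
p⊆q⇒q─[q─p]≡p {p = p} {q = q} p⊆q = ⊆-antisym q─[q─p]⊆p
  (λ x∈p → x∈p∧x∉q⇒x∈p─q (p⊆q x∈p) (λ x∈q─p → proj₂ (x∈p─q⁻ x∈q─p) x∈p))
  where
  q─[q─p]⊆p : q ─ (q ─ p) ⊆ p
  q─[q─p]⊆p {x} x∈ with x ∈? p | x∈p─q⁻ x∈
  ... | yes x∈p | _ = x∈p
  ... | no x∉p | x∈q , x∉q─p = contradiction (x∈p∧x∉q⇒x∈p─q x∈q x∉p) x∉q─p

p⊆q⇒p∩[q-x]≡p-x : p ⊆ q → p ∩ (q - x) ≡ p - x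
p⊆q⇒p∩[q-x]≡p-x {p = p} {q = q} p⊆q = ⊆-antisym
  (λ x∈ → let y∈p , y∈q-x = x∈p∩q⁻ p (q - _) x∈ in x∈p∧x≢y⇒x∈p-y y∈p (proj₂ (x∈p-y⁻ y∈q-x)))
  (λ x∈ → let y∈p , y≢x = x∈p-y⁻ x∈ in x∈p∩q⁺ (y∈p , x∈p∧x≢y⇒x∈p-y (p⊆q y∈p) y≢x))

x∈p⇒p⊆q⇒p∪[q-x]≡q : x ∈ p → p ⊆ q → p ∪ (q - x) ≡ q
x∈p⇒p⊆q⇒p∪[q-x]≡q {x = x} {p = p} {q = q} x∈p p⊆q =
  ⊆-antisym (∪-lub p⊆q (p─q⊆p q ⁅ x ⁆)) q⊆p∪[q-x]
  where
  q⊆p∪[q-x] : q ⊆ p ∪ (q - x)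
  q⊆p∪[q-x] {y} y∈q with y Fin.≟ x
  ... | yes refl = x∈p∪q⁺ (inj₁ x∈p)
  ... | no y≢x = x∈p∪q⁺ (inj₂ (x∈p∧x≢y⇒x∈p-y y∈q y≢x))

x∈q⇒[p-x]─[q-x]≡p─q : x ∈ q → (p - x) ─ (q - x) ≡ p ─ q
x∈q⇒[p-x]─[q-x]≡p─q {x = x} {q = q} {p = p} x∈q = ⊆-antisym
  (λ y∈ → let y∈p-x , y∉q-x = x∈p─q⁻ y∈ ; y∈p , y≢x = x∈p-y⁻ y∈p-x in
          x∈p∧x∉q⇒x∈p─q y∈p (y∉q-x ∘ λ y∈q → x∈p∧x≢y⇒x∈p-y y∈q y≢x))
  (λ y∈ → let y∈p , y∉q = x∈p─q⁻ y∈ in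
          x∈p∧x∉q⇒x∈p─q (x∈p∧x≢y⇒x∈p-y y∈p λ { refl → y∉q x∈q }) (y∉q ∘ proj₁ ∘ x∈p-y⁻))

x∈p⇒p─[q-x]≡[p─q]∪⁅x⁆ : x ∈ p → p ─ (q - x) ≡ (p ─ q) ∪ ⁅ x ⁆
x∈p⇒p─[q-x]≡[p─q]∪⁅x⁆ {x = x} {p = p} {q = q} x∈p = ⊆-antisym ⊆-∪ ∪-⊆
  where
  ⊆-∪ : p ─ (q - x) ⊆ (p ─ q) ∪ ⁅ x ⁆
  ⊆-∪ {y} y∈ with y Fin.≟ x | x∈p─q⁻ y∈
  ... | yes refl | _ = x∈p∪q⁺ (inj₂ (x∈⁅x⁆ x))
  ... | no y≢x | y∈p , y∉q-x = x∈p∪q⁺ (inj₁ (x∈p∧x∉q⇒x∈p─q y∈p (y∉q-x ∘ λ y∈q → x∈p∧x≢y⇒x∈p-y y∈q y≢x)))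
  ∪-⊆ : (p ─ q) ∪ ⁅ x ⁆ ⊆ p ─ (q - x)
  ∪-⊆ = ∪-lub (λ y∈ → let y∈p , y∉q = x∈p─q⁻ y∈ in x∈p∧x∉q⇒x∈p─q y∈p (y∉q ∘ proj₁ ∘ x∈p-y⁻))
              (⁅x⁆⊆p (x∈p∧x∉q⇒x∈p─q x∈p λ x∈q-x → proj₂ (x∈p-y⁻ x∈q-x) refl))

x∉p⇒∣p∪⁅x⁆∣≡1+∣p∣ : x ∉ p → ∣ p ∪ ⁅ x ⁆ ∣ ≡ suc ∣ p ∣
x∉p⇒∣p∪⁅x⁆∣≡1+∣p∣ {x = Fin.zero} {p = outside ∷ p} _ = cong (suc ∘ ∣_∣) (∪-identityʳ p)
x∉p⇒∣p∪⁅x⁆∣≡1+∣p∣ {x = Fin.zero} {p = inside ∷ p} x∉p = contradiction here x∉p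
x∉p⇒∣p∪⁅x⁆∣≡1+∣p∣ {x = Fin.suc x} {p = inside ∷ p} x∉p = cong suc (x∉p⇒∣p∪⁅x⁆∣≡1+∣p∣ (x∉p ∘ there))
x∉p⇒∣p∪⁅x⁆∣≡1+∣p∣ {x = Fin.suc x} {p = outside ∷ p} x∉p = x∉p⇒∣p∪⁅x⁆∣≡1+∣p∣ (x∉p ∘ there)

∣p∣≡1+∣p-x∣ : x ∈ p → ∣ p ∣ ≡ suc ∣ p - x ∣
∣p∣≡1+∣p-x∣ {p = inside ∷ p} here = cong (suc ∘ ∣_∣) (sym (p─⊥≡p p))
∣p∣≡1+∣p-x∣ {p = inside ∷ p} (there x∈p) = cong suc (∣p∣≡1+∣p-x∣ x∈p)
∣p∣≡1+∣p-x∣ {p = outside ∷ p} (there x∈p) = ∣p∣≡1+∣p-x∣ x∈p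

─-monoˡ : p ⊆ q → p ─ t ⊆ q ─ t
─-monoˡ {p = p} {t = t} p⊆q x∈p─t =
  let x∈p , x∉t = x∈p─q⁻ {p = p} {q = t} x∈p─t in x∈p∧x∉q⇒x∈p─q (p⊆q x∈p) x∉t

x∉p⇒[p∪⁅x⁆]-x≡p : x ∉ p → (p ∪ ⁅ x ⁆) - x ≡ p
x∉p⇒[p∪⁅x⁆]-x≡p {x = x} {p = p} x∉p = ⊆-antisym
  (λ y∈ → let y∈p∪x , y≢x = x∈p-y⁻ y∈ in
          [ (λ y∈p → y∈p) , (λ y∈⁅x⁆ → contradiction (x∈⁅y⁆⇒x≡y x y∈⁅x⁆) y≢x) ]′ (x∈p∪q⁻ p ⁅ x ⁆ y∈p∪x))
  (λ y∈p → x∈p∧x≢y⇒x∈p-y (x∈p∪q⁺ (inj₁ y∈p)) λ { refl → x∉p y∈p })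

⋂⊆ : ∀ {ps} → p ∈ₗ ps → ⋂ ps ⊆ p
⋂⊆ (Any.here refl) x∈ = proj₁ (x∈p∩q⁻ _ _ x∈)
⋂⊆ (Any.there p∈ps) x∈ = ⋂⊆ p∈ps (proj₂ (x∈p∩q⁻ _ _ x∈))

x∈⋃⁺ : ∀ {ps : List (Subset n)} → Any (x ∈_) ps → x ∈ ⋃ ps
x∈⋃⁺ (Any.here x∈p) = x∈p∪q⁺ (inj₁ x∈p)
x∈⋃⁺ (Any.there x∈ps) = x∈p∪q⁺ (inj₂ (x∈⋃⁺ x∈ps))

x∈⋃⁻ : ∀ (ps : List (Subset n)) → x ∈ ⋃ ps → Any (x ∈_) ps
x∈⋃⁻ [] x∈⊥ = contradiction x∈⊥ ∉⊥
x∈⋃⁻ (p ∷ ps) x∈ = [ Any.here , Any.there ∘ x∈⋃⁻ ps ]′ (x∈p∪q⁻ p (⋃ ps) x∈)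

⋃-map-─ : ∀ {a} {A : Set a} (g : A → Subset n) xs q → ⋃ (map g xs) ─ q ≡ ⋃ (map (λ x → g x ─ q) xs)
⋃-map-─ g [] q = ⊥─p≡⊥ q
⋃-map-─ g (x ∷ xs) q = trans ([p∪q]─r≡[p─r]∪[q─r] (g x) _ q) (cong ((g x ─ q) ∪_) (⋃-map-─ g xs q))

foldr-preserves-nonempty : ∀ {a ℓ} {A : Set a} {P : A → Set ℓ} {_•_ : A → A → A} {ε : A} →
  (∀ x → x • ε ≡ x) → (∀ {x y} → P x → P y → P (x • y)) →
  ∀ {x xs} → x ∈ₗ xs → All P xs → P (foldr _•_ ε xs)
foldr-preserves-nonempty {P = P} identityʳ _ {xs = y ∷ []} _ (py ∷ []) = subst P (sym (identityʳ y)) py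
foldr-preserves-nonempty identityʳ pres {xs = y ∷ z ∷ zs} _ (py ∷ pzs) =
  pres py (foldr-preserves-nonempty identityʳ pres (Any.here refl) pzs)

⋃-preserves : ∀ {ℓ} {P : Subset n → Set ℓ} → (∀ {A B} → P A → P B → P (A ∪ B)) →
  ∀ {p ps} → p ∈ₗ ps → All P ps → P (⋃ ps)
⋃-preserves = foldr-preserves-nonempty ∪-identityʳ

⋂-preserves : ∀ {ℓ} {P : Subset n → Set ℓ} → (∀ {A B} → P A → P B → P (A ∩ B)) →
  ∀ {p ps} → p ∈ₗ ps → All P ps → P (⋂ ps)
⋂-preserves = foldr-preserves-nonempty ∩-identityʳ

∈-allSubsets : ∀ (X : Subset n) → X ∈ₗ allSubsets n
∈-allSubsets [] = Any.here refl
∈-allSubsets (inside ∷ X) = ∈-++⁺ˡ (∈-map⁺ (inside ∷_) (∈-allSubsets X))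
∈-allSubsets {suc n} (outside ∷ X) =
  ∈-++⁺ʳ (map (inside ∷_) (allSubsets n)) (∈-map⁺ (outside ∷_) (∈-allSubsets X))

module LeastMember {P : Subset n → Set} (P? : ∀ A → Dec (P A)) (P-∩ : ∀ {A B} → P A → P B → P (A ∩ B)) where

  least : Subset n
  least = ⋂ (filter P? (allSubsets n))

  least⊆ : ∀ {A} → P A → least ⊆ A
  least⊆ PA = ⋂⊆ (∈-filter⁺ P? (∈-allSubsets _) PA)

  P-least : ∀ {A} → P A → P least
  P-least PA = ⋂-preserves P-∩ (∈-filter⁺ P? (∈-allSubsets _) PA) (all-filter P? (allSubsets n))

-- Enumerating a finite set in order of a key

record SortedEnumeration (key : Fin n → ℕ) (c : ℕ) (F : Subset n) : Set where
  field
    enum      : Fin c → Fin n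
    injective : Injective _≡_ _≡_ enum
    image     : ∀ x → x ∈ F ⇔ (∃[ i ] enum i ≡ x)
    sorted    : ∀ i j → toℕ i ≤ toℕ j → key (enum i) ≤ key (enum j)

  enum∈F : ∀ i → enum i ∈ F
  enum∈F i = Equivalence.from (image (enum i)) (i , refl)

sortedEnumeration : ∀ (key : Fin n → ℕ) c F → ∣ F ∣ ≡ c → SortedEnumeration key c F
sortedEnumeration key zero F ∣F∣≡0 = record
  { enum      = λ ()
  ; injective = λ { {()} }
  ; image     = λ x → mk⇔ (λ x∈F → contradiction (trans (sym ∣F∣≡0) (∣p∣≡1+∣p-x∣ x∈F)) 0≢1+n) λ ()
  ; sorted    = λ ()
  }
sortedEnumeration {n} key (suc c) F ∣F∣≡1+c with nonempty? F
... | no F-empty =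
  contradiction (trans (sym ∣F∣≡1+c) (trans (cong ∣_∣ (Empty-unique F-empty)) (∣⊥∣≡0 n))) 1+n≢0
... | yes (x₀ , x₀∈F) = record
  { enum      = enum
  ; injective = injective
  ; image     = λ x → mk⇔ (index x) λ { (i , refl) → enum∈F i }
  ; sorted    = sorted
  }
  where
  members = filter (_∈? F) (allFin n)
  m = argmin key x₀ members
  m∈F : m ∈ F
  m∈F = argmin-all key x₀∈F (all-filter (_∈? F) (allFin n))
  m-least : ∀ {y} → y ∈ F → key m ≤ key y
  m-least {y} y∈F = f[argmin]≤v⁺ x₀ members (inj₂ (lose (∈-filter⁺ (_∈? F) (∈-allFin y) y∈F) ≤-refl))
  module Rest = SortedEnumeration
    (sortedEnumeration key c (F - m) (suc-injective (trans (sym (∣p∣≡1+∣p-x∣ m∈F)) ∣F∣≡1+c)))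
  enum : Fin (suc c) → Fin n
  enum Fin.zero = m
  enum (Fin.suc i) = Rest.enum i
  enum∈F : ∀ i → enum i ∈ F
  enum∈F Fin.zero = m∈F
  enum∈F (Fin.suc i) = proj₁ (x∈p-y⁻ (Rest.enum∈F i))
  rest≢m : ∀ i → Rest.enum i ≢ m
  rest≢m i = proj₂ (x∈p-y⁻ (Rest.enum∈F i))
  injective : Injective _≡_ _≡_ enum
  injective {Fin.zero} {Fin.zero} _ = refl
  injective {Fin.zero} {Fin.suc j} m≡ = contradiction (sym m≡) (rest≢m j)
  injective {Fin.suc i} {Fin.zero} ≡m = contradiction ≡m (rest≢m i)
  injective {Fin.suc i} {Fin.suc j} eq = cong Fin.suc (Rest.injective eq)
  index : ∀ x → x ∈ F → ∃[ i ] enum i ≡ x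
  index x x∈F with x Fin.≟ m
  ... | yes refl = Fin.zero , refl
  ... | no x≢m = let i , eq = Equivalence.to (Rest.image x) (x∈p∧x≢y⇒x∈p-y x∈F x≢m) in Fin.suc i , eq
  sorted : ∀ i j → toℕ i ≤ toℕ j → key (enum i) ≤ key (enum j)
  sorted Fin.zero j _ = m-least (enum∈F j)
  sorted (Fin.suc i) (Fin.suc j) (s≤s i≤j) = Rest.sorted i j i≤j

minimumWith≤ : ∀ d xs {y} → y ∈ₗ xs → minimumWith d xs ≤ y
minimumWith≤ d (x ∷ xs) {y} y∈x∷xs =
  foldr-preservesᵒ {P = _≤ y} (λ a b → [ m≤n⇒m⊓o≤n b , m≤n⇒o⊓m≤n a ]′) x xs (bound y∈x∷xs)
  where
  bound : y ∈ₗ x ∷ xs → x ≤ y ⊎ Any (_≤ y) xs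
  bound (Any.here refl) = inj₁ ≤-refl
  bound (Any.there y∈xs) = inj₂ (lose y∈xs ≤-refl)

minimumWith-sel : ∀ d xs → minimumWith d xs ≡ d ⊎ minimumWith d xs ∈ₗ xs
minimumWith-sel d [] = inj₁ refl
minimumWith-sel d (x ∷ xs) = inj₂ ([ Any.here , Any.there ]′ (foldr-selective ⊓-sel x xs))

module _ (M : MatroidData n) (S T : Subset n) where

  private
    between? : ∀ X → Dec (S ⊆ X × X ⊆ E M ─ T)
    between? X = (S ⊆? X) ×-dec (X ⊆? (E M ─ T))

  kappa≤conn : ∀ {X} → S ⊆ X → X ⊆ E M ─ T → kappa M S T ≤ conn M X
  kappa≤conn {X} S⊆X X⊆E─T =
    minimumWith≤ (conn M S) _ (∈-map⁺ (conn M) (∈-filter⁺ between? (∈-allSubsets X) (S⊆X , X⊆E─T)))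

  kappa-attained : S ⊆ E M ─ T → ∃[ X ] (S ⊆ X × X ⊆ E M ─ T × conn M X ≡ kappa M S T)
  kappa-attained S⊆E─T with minimumWith-sel (conn M S) (map (conn M) (filter between? (allSubsets n)))
  ... | inj₁ κ≡connS = S , ⊆-refl , S⊆E─T , sym κ≡connS
  ... | inj₂ κ∈ with ∈-map⁻ (conn M) κ∈
  ...   | X , X∈ , κ≡connX =
    let S⊆X , X⊆E─T = proj₂ (∈-filter⁻ between? {xs = allSubsets n} X∈) in X , S⊆X , X⊆E─T , sym κ≡connX

conn-complement : ∀ (M : MatroidData n) {X} → X ⊆ E M → conn M (E M ─ X) ≡ conn M X
conn-complement M {X} X⊆E =
  cong (_∸ rk M (E M)) (trans (cong (λ Y → rk M (E M ─ X) + rk M Y) (p⊆q⇒q─[q─p]≡p X⊆E))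
                             (+-comm (rk M (E M ─ X)) (rk M X)))

-- Both M \ e and M / e have this form, so the complement arguments below serve for both.
module OneElementMinor (M : MatroidData n) {e : Fin n} (e∈E : e ∈ E M) (ρ : Subset n → ℕ) where

  N : MatroidData n
  N = mkMatroid (E M - e) ρ

  conn-shrink : (∀ {X} → X ⊆ E M → e ∈ X → conn N (X - e) ≤ conn M X) →
                ∀ {X} → X ⊆ E M → conn N (X - e) ≤ conn M X
  conn-shrink shrink {X} X⊆E with e ∈? X
  ... | yes e∈X = shrink X⊆E e∈X
  ... | no e∉X = begin
    conn N (X - e)          ≡⟨ cong (conn N) (x∉p⇒p-x≡p e∉X) ⟩
    conn N X                ≡⟨ conn-complement N X⊆E-e ⟨
    conn N (E M - e ─ X)    ≡⟨ cong (conn N) (p─q─r≡p─r─q (E M) ⁅ e ⁆ X) ⟩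
    conn N ((E M ─ X) - e)  ≤⟨ shrink (p─q⊆p (E M) X) (x∈p∧x∉q⇒x∈p─q e∈E e∉X) ⟩
    conn M (E M ─ X)        ≡⟨ conn-complement M X⊆E ⟩
    conn M X                ∎
    where
    open ≤-Reasoning
    X⊆E-e : X ⊆ E M - e
    X⊆E-e x∈X = x∈p∧x≢y⇒x∈p-y (X⊆E x∈X) λ { refl → e∉X x∈X }

  conn-grow : (∀ {Y} → Y ⊆ E M - e → conn M (Y ∪ ⁅ e ⁆) ≤ suc (conn N Y)) →
              ∀ {Y} → Y ⊆ E M - e → conn M Y ≤ suc (conn N Y)
  conn-grow grow {Y} Y⊆E-e = begin
    conn M Y                    ≡⟨ conn-complement M Y⊆E ⟨
    conn M (E M ─ Y)            ≡⟨ cong (conn M) E─Y≡Z∪e ⟩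
    conn M ((E M - e ─ Y) ∪ ⁅ e ⁆) ≤⟨ grow (p─q⊆p (E M - e) Y) ⟩
    suc (conn N (E M - e ─ Y))  ≡⟨ cong suc (conn-complement N Y⊆E-e) ⟩
    suc (conn N Y)              ∎
    where
    open ≤-Reasoning
    Y⊆E : Y ⊆ E M
    Y⊆E = proj₁ ∘ x∈p-y⁻ ∘ Y⊆E-e
    e∈E─Y : e ∈ E M ─ Y
    e∈E─Y = x∈p∧x∉q⇒x∈p─q e∈E λ e∈Y → proj₂ (x∈p-y⁻ (Y⊆E-e e∈Y)) refl
    E─Y≡Z∪e : E M ─ Y ≡ (E M - e ─ Y) ∪ ⁅ e ⁆
    E─Y≡Z∪e = sym (trans (cong (_∪ ⁅ e ⁆) (p─q─r≡p─r─q (E M) ⁅ e ⁆ Y)) (x∈p⇒p-x∪⁅x⁆≡p e∈E─Y))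

-- Rank inequalities in a matroid

module _ (M : MatroidData n) (isM : IsMatroid M) where

  open IsMatroid isM

  private
    r = rk M
    variable
      A B X Y : Subset n
      e : Fin n

  r-subadditive : X ⊆ E M → Y ⊆ E M → r (X ∪ Y) ≤ r X + r Y
  r-subadditive X⊆E Y⊆E = ≤-trans (m≤m+n _ _) (R3 _ _ X⊆E Y⊆E)

  r-∪⁅⁆-mono : X ⊆ E M → e ∈ E M → r X ≤ r (X ∪ ⁅ e ⁆)
  r-∪⁅⁆-mono X⊆E e∈E = R2 _ _ (x∈p∪q⁺ ∘ inj₁) (∪-lub X⊆E (⁅x⁆⊆p e∈E))

  r⁅e⁆≤1 : e ∈ E M → r ⁅ e ⁆ ≤ 1
  r⁅e⁆≤1 {e} e∈E = subst (r ⁅ e ⁆ ≤_) (∣⁅x⁆∣≡1 e) (R1 ⁅ e ⁆ (⁅x⁆⊆p e∈E))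

  r-∪⁅⁆≤1+r : X ⊆ E M → e ∈ E M → r (X ∪ ⁅ e ⁆) ≤ suc (r X)
  r-∪⁅⁆≤1+r {X} X⊆E e∈E = begin
    r (X ∪ ⁅ _ ⁆)  ≤⟨ r-subadditive X⊆E (⁅x⁆⊆p e∈E) ⟩
    r X + r ⁅ _ ⁆  ≤⟨ +-monoʳ-≤ (r X) (r⁅e⁆≤1 e∈E) ⟩
    r X + 1        ≡⟨ +-comm (r X) 1 ⟩
    suc (r X)      ∎
    where open ≤-Reasoning

  conn+r≡r+r : X ⊆ E M → conn M X + r (E M) ≡ r X + r (E M ─ X)
  conn+r≡r+r {X} X⊆E = m∸n+n≡m (begin
    r (E M)                ≡⟨ cong r (p⊆q⇒p∪[q─p]≡q X⊆E) ⟨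
    r (X ∪ (E M ─ X))      ≤⟨ r-subadditive X⊆E (p─q⊆p (E M) X) ⟩
    r X + r (E M ─ X)      ∎)
    where open ≤-Reasoning

  conn-submodular : A ⊆ E M → B ⊆ E M → conn M (A ∪ B) + conn M (A ∩ B) ≤ conn M A + conn M B
  conn-submodular {A} {B} A⊆E B⊆E = +-cancelʳ-≤ (r (E M) + r (E M)) _ _ (begin
    conn M (A ∪ B) + conn M (A ∩ B) + (r (E M) + r (E M))
      ≡⟨ interchange (conn M (A ∪ B)) _ _ _ ⟩
    (conn M (A ∪ B) + r (E M)) + (conn M (A ∩ B) + r (E M))
      ≡⟨ cong₂ _+_ (conn+r≡r+r (∪-lub A⊆E B⊆E)) (conn+r≡r+r (A⊆E ∘ proj₁ ∘ x∈p∩q⁻ A B)) ⟩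
    (r (A ∪ B) + r (E M ─ (A ∪ B))) + (r (A ∩ B) + r (E M ─ (A ∩ B)))
      ≡⟨ interchange (r (A ∪ B)) _ _ _ ⟩
    (r (A ∪ B) + r (A ∩ B)) + (r (E M ─ (A ∪ B)) + r (E M ─ (A ∩ B)))
      ≡⟨ cong (r (A ∪ B) + r (A ∩ B) +_) (+-comm (r (E M ─ (A ∪ B))) _) ⟩
    (r (A ∪ B) + r (A ∩ B)) + (r (E M ─ (A ∩ B)) + r (E M ─ (A ∪ B)))
      ≡⟨ cong₂ (λ U V → r (A ∪ B) + r (A ∩ B) + (r U + r V))
           (p─[q∩r]≡[p─q]∪[p─r] (E M) A B) (p─[q∪r]≡[p─q]∩[p─r] (E M) A B) ⟩
    (r (A ∪ B) + r (A ∩ B)) + (r ((E M ─ A) ∪ (E M ─ B)) + r ((E M ─ A) ∩ (E M ─ B)))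
      ≤⟨ +-mono-≤ (R3 A B A⊆E B⊆E) (R3 _ _ (p─q⊆p (E M) A) (p─q⊆p (E M) B)) ⟩
    (r A + r B) + (r (E M ─ A) + r (E M ─ B))
      ≡⟨ interchange (r A) _ _ _ ⟩
    (r A + r (E M ─ A)) + (r B + r (E M ─ B))
      ≡⟨ cong₂ _+_ (conn+r≡r+r A⊆E) (conn+r≡r+r B⊆E) ⟨
    (conn M A + r (E M)) + (conn M B + r (E M))
      ≡⟨ interchange (conn M A) _ _ _ ⟩
    conn M A + conn M B + (r (E M) + r (E M)) ∎)
    where open ≤-Reasoning

  r[X-e]+r[E]≤r[X]+r[E-e] : X ⊆ E M → e ∈ X → r (X - e) + r (E M) ≤ r X + r (E M - e)
  r[X-e]+r[E]≤r[X]+r[E-e] {X} {e} X⊆E e∈X = begin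
    r (X - e) + r (E M)                    ≡⟨ +-comm (r (X - e)) _ ⟩
    r (E M) + r (X - e)                    ≡⟨ cong₂ (λ U V → r U + r V)
                                                (x∈p⇒p⊆q⇒p∪[q-x]≡q e∈X X⊆E) (p⊆q⇒p∩[q-x]≡p-x X⊆E) ⟨
    r (X ∪ (E M - e)) + r (X ∩ (E M - e))  ≤⟨ R3 X (E M - e) X⊆E (p─q⊆p (E M) ⁅ e ⁆) ⟩
    r X + r (E M - e)                      ∎
    where open ≤-Reasoning

  conn-delete-shrink : X ⊆ E M → e ∈ X → conn (delete M e) (X - e) ≤ conn M X
  conn-delete-shrink {X} {e} X⊆E e∈X = m+q≤o+n⇒m∸n≤o∸q _ (r (E M - e)) _ (r (E M)) (begin
    r (X - e) + r (E M - e ─ (X - e)) + r (E M)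
      ≡⟨ cong (λ U → r (X - e) + r U + r (E M)) (x∈q⇒[p-x]─[q-x]≡p─q e∈X) ⟩
    r (X - e) + r (E M ─ X) + r (E M)  ≡⟨ xy∙z≈xz∙y (r (X - e)) _ _ ⟩
    r (X - e) + r (E M) + r (E M ─ X)  ≤⟨ +-monoˡ-≤ _ (r[X-e]+r[E]≤r[X]+r[E-e] X⊆E e∈X) ⟩
    r X + r (E M - e) + r (E M ─ X)    ≡⟨ xy∙z≈xz∙y (r X) _ _ ⟩
    r X + r (E M ─ X) + r (E M - e)    ∎)
    where open ≤-Reasoning

  conn-delete-grow : e ∈ E M → Y ⊆ E M - e → conn M (Y ∪ ⁅ e ⁆) ≤ suc (conn (delete M e) Y)
  conn-delete-grow {e} {Y} e∈E Y⊆E-e = m+q≤1+o+n⇒m∸n≤1+o∸q _ (r (E M)) _ (r (E M - e)) (begin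
    r (Y ∪ ⁅ e ⁆) + r (E M ─ (Y ∪ ⁅ e ⁆)) + r (E M - e)
      ≡⟨ cong (λ U → r (Y ∪ ⁅ e ⁆) + r U + r (E M - e)) (p─[q∪⁅x⁆]≡p-x─q (E M) Y e) ⟩
    r (Y ∪ ⁅ e ⁆) + r (E M - e ─ Y) + r (E M - e)
      ≤⟨ +-mono-≤ (+-monoˡ-≤ _ (r-∪⁅⁆≤1+r (proj₁ ∘ x∈p-y⁻ ∘ Y⊆E-e) e∈E))
                  (R2 _ _ (p─q⊆p (E M) ⁅ e ⁆) ⊆-refl) ⟩
    suc (r Y + r (E M - e ─ Y) + r (E M)) ∎)
    where open ≤-Reasoning

  conn-contract : e ∈ E M → X ⊆ E M - e →
    conn (contract M e) X ≡ r (X ∪ ⁅ e ⁆) + r ((E M - e ─ X) ∪ ⁅ e ⁆) ∸ (r (E M) + r ⁅ e ⁆)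
  conn-contract {e} {X} e∈E X⊆E-e = trans
    ([m∸o]+[n∸o]∸[p∸o]≡[m+n]∸[p+o] (r⁅e⁆≤ X⊆E-e) (r⁅e⁆≤ (p─q⊆p (E M - e) _)) (r⁅e⁆≤ ⊆-refl))
    (cong (λ U → r (X ∪ ⁅ e ⁆) + r ((E M - e ─ X) ∪ ⁅ e ⁆) ∸ (r U + r ⁅ e ⁆)) (x∈p⇒p-x∪⁅x⁆≡p e∈E))
    where
    r⁅e⁆≤ : ∀ {Z} → Z ⊆ E M - e → r ⁅ e ⁆ ≤ r (Z ∪ ⁅ e ⁆)
    r⁅e⁆≤ Z⊆E-e = R2 _ _ (x∈p∪q⁺ ∘ inj₂) (∪-lub (proj₁ ∘ x∈p-y⁻ ∘ Z⊆E-e) (⁅x⁆⊆p e∈E))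

  conn-contract-shrink : X ⊆ E M → e ∈ X → conn (contract M e) (X - e) ≤ conn M X
  conn-contract-shrink {X} {e} X⊆E e∈X =
    subst (_≤ conn M X) (sym (conn-contract e∈E X-e⊆E-e))
      (m+q≤o+n⇒m∸n≤o∸q _ (r (E M) + r ⁅ e ⁆) _ (r (E M)) (begin
        r ((X - e) ∪ ⁅ e ⁆) + r ((E M - e ─ (X - e)) ∪ ⁅ e ⁆) + r (E M)
          ≡⟨ cong₂ (λ U V → r U + r (V ∪ ⁅ e ⁆) + r (E M))
               (x∈p⇒p-x∪⁅x⁆≡p e∈X) (x∈q⇒[p-x]─[q-x]≡p─q e∈X) ⟩
        r X + r ((E M ─ X) ∪ ⁅ e ⁆) + r (E M)
          ≤⟨ +-monoˡ-≤ _ (+-monoʳ-≤ (r X) (r-subadditive (p─q⊆p (E M) X) (⁅x⁆⊆p e∈E))) ⟩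
        r X + (r (E M ─ X) + r ⁅ e ⁆) + r (E M)
          ≡⟨ cong (_+ r (E M)) (+-assoc (r X) (r (E M ─ X)) (r ⁅ e ⁆)) ⟨
        r X + r (E M ─ X) + r ⁅ e ⁆ + r (E M)
          ≡⟨ +-assoc (r X + r (E M ─ X)) (r ⁅ e ⁆) (r (E M)) ⟩
        r X + r (E M ─ X) + (r ⁅ e ⁆ + r (E M))
          ≡⟨ cong (r X + r (E M ─ X) +_) (+-comm (r ⁅ e ⁆) (r (E M))) ⟩
        r X + r (E M ─ X) + (r (E M) + r ⁅ e ⁆) ∎))
    where
    open ≤-Reasoning
    e∈E = X⊆E e∈X
    X-e⊆E-e : X - e ⊆ E M - e
    X-e⊆E-e x∈X-e = let x∈X , x≢e = x∈p-y⁻ x∈X-e in x∈p∧x≢y⇒x∈p-y (X⊆E x∈X) x≢e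

  conn-contract-grow : e ∈ E M → Y ⊆ E M - e → conn M (Y ∪ ⁅ e ⁆) ≤ suc (conn (contract M e) Y)
  conn-contract-grow {e} {Y} e∈E Y⊆E-e =
    subst (λ c → conn M (Y ∪ ⁅ e ⁆) ≤ suc c) (sym (conn-contract e∈E Y⊆E-e))
      (m+q≤1+o+n⇒m∸n≤1+o∸q _ (r (E M)) _ (r (E M) + r ⁅ e ⁆) (begin
        r (Y ∪ ⁅ e ⁆) + r (E M ─ (Y ∪ ⁅ e ⁆)) + (r (E M) + r ⁅ e ⁆)
          ≡⟨ cong (λ U → r (Y ∪ ⁅ e ⁆) + r U + (r (E M) + r ⁅ e ⁆)) (p─[q∪⁅x⁆]≡p-x─q (E M) Y e) ⟩
        r (Y ∪ ⁅ e ⁆) + r Z + (r (E M) + r ⁅ e ⁆)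
          ≤⟨ +-mono-≤ (+-monoʳ-≤ (r (Y ∪ ⁅ e ⁆)) (r-∪⁅⁆-mono (proj₁ ∘ x∈p-y⁻ ∘ p─q⊆p (E M - e) Y) e∈E))
                      (+-monoʳ-≤ (r (E M)) (r⁅e⁆≤1 e∈E)) ⟩
        r (Y ∪ ⁅ e ⁆) + r (Z ∪ ⁅ e ⁆) + (r (E M) + 1)
          ≡⟨ trans (cong (r (Y ∪ ⁅ e ⁆) + r (Z ∪ ⁅ e ⁆) +_) (+-comm (r (E M)) 1)) (+-suc _ (r (E M))) ⟩
        suc (r (Y ∪ ⁅ e ⁆) + r (Z ∪ ⁅ e ⁆) + r (E M)) ∎))
    where
    open ≤-Reasoning
    Z = E M - e ─ Y

  InCoCl-intro : e ∈ E M → e ∉ X → suc (r (E M ─ (X ∪ ⁅ e ⁆))) ≡ r (E M ─ X) → InCoCl M X e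
  InCoCl-intro {e} {X} e∈E e∉X rank-drop = e∈E , (begin
    ∣ X ∪ ⁅ e ⁆ ∣ + r (E M ─ (X ∪ ⁅ e ⁆)) ∸ r (E M)
      ≡⟨ cong (λ k → k + r (E M ─ (X ∪ ⁅ e ⁆)) ∸ r (E M)) (x∉p⇒∣p∪⁅x⁆∣≡1+∣p∣ e∉X) ⟩
    suc ∣ X ∣ + r (E M ─ (X ∪ ⁅ e ⁆)) ∸ r (E M)
      ≡⟨ cong (_∸ r (E M)) (+-suc ∣ X ∣ _) ⟨
    ∣ X ∣ + suc (r (E M ─ (X ∪ ⁅ e ⁆))) ∸ r (E M)
      ≡⟨ cong (λ k → ∣ X ∣ + k ∸ r (E M)) rank-drop ⟩
    ∣ X ∣ + r (E M ─ X) ∸ r (E M)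
      ∎)
    where open ≡-Reasoning

  -- Writing A′ = A - e and Aᶜ = E - A, both (A′ ∪ e, Aᶜ) and (A′, Aᶜ ∪ e) are complementary
  -- pairs with the same connectivity, so adding e raises the ranks of A′ and Aᶜ equally.
  conn[A-e]≡conn[A]⇒guts⊎coguts : A ⊆ E M → e ∈ A → conn M (A - e) ≡ conn M A →
    (InCl M (A - e) e × InCl M (E M ─ A) e) ⊎ (InCoCl M (A - e) e × InCoCl M (E M ─ A) e)
  conn[A-e]≡conn[A]⇒guts⊎coguts {A} {e} A⊆E e∈A conn≡ = by-cases (r (A′ ∪ ⁅ e ⁆) ≟ r A′)
    where
    A′ = A - e
    Aᶜ = E M ─ A
    e∈E = A⊆E e∈A
    A′⊆E : A′ ⊆ E M
    A′⊆E = A⊆E ∘ p─q⊆p A ⁅ e ⁆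
    A′∪e≡A : A′ ∪ ⁅ e ⁆ ≡ A
    A′∪e≡A = x∈p⇒p-x∪⁅x⁆≡p e∈A
    E─A′≡Aᶜ∪e : E M ─ A′ ≡ Aᶜ ∪ ⁅ e ⁆
    E─A′≡Aᶜ∪e = x∈p⇒p─[q-x]≡[p─q]∪⁅x⁆ e∈E
    exchange : r (A′ ∪ ⁅ e ⁆) + r Aᶜ ≡ r A′ + r (Aᶜ ∪ ⁅ e ⁆)
    exchange = begin
      r (A′ ∪ ⁅ e ⁆) + r Aᶜ  ≡⟨ cong (λ U → r U + r Aᶜ) A′∪e≡A ⟩
      r A + r Aᶜ             ≡⟨ conn+r≡r+r A⊆E ⟨
      conn M A + r (E M)     ≡⟨ cong (_+ r (E M)) conn≡ ⟨
      conn M A′ + r (E M)    ≡⟨ conn+r≡r+r A′⊆E ⟩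
      r A′ + r (E M ─ A′)    ≡⟨ cong (λ U → r A′ + r U) E─A′≡Aᶜ∪e ⟩
      r A′ + r (Aᶜ ∪ ⁅ e ⁆)  ∎
      where open ≡-Reasoning
    by-cases : Dec (r (A′ ∪ ⁅ e ⁆) ≡ r A′) →
      (InCl M A′ e × InCl M Aᶜ e) ⊎ (InCoCl M A′ e × InCoCl M Aᶜ e)
    by-cases (yes r[A′∪e]≡r[A′]) = inj₁ ((e∈E , r[A′∪e]≡r[A′]) , (e∈E , sym r[Aᶜ∪e]≡r[Aᶜ]))
      where
      r[Aᶜ∪e]≡r[Aᶜ] : r Aᶜ ≡ r (Aᶜ ∪ ⁅ e ⁆)
      r[Aᶜ∪e]≡r[Aᶜ] = +-cancelˡ-≡ (r A′) _ _ (trans (cong (_+ r Aᶜ) (sym r[A′∪e]≡r[A′])) exchange)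
    by-cases (no r[A′∪e]≢r[A′]) = inj₂
      ( InCoCl-intro e∈E (λ e∈A′ → proj₂ (x∈p-y⁻ e∈A′) refl) A′-drop
      , InCoCl-intro e∈E (λ e∈Aᶜ → proj₂ (x∈p─q⁻ e∈Aᶜ) e∈A) Aᶜ-drop )
      where
      r[A′∪e]≡1+r[A′] : r (A′ ∪ ⁅ e ⁆) ≡ suc (r A′)
      r[A′∪e]≡1+r[A′] = ≤-antisym (r-∪⁅⁆≤1+r A′⊆E e∈E) (≤∧≢⇒< (r-∪⁅⁆-mono A′⊆E e∈E) (r[A′∪e]≢r[A′] ∘ sym))
      1+r[Aᶜ]≡r[Aᶜ∪e] : suc (r Aᶜ) ≡ r (Aᶜ ∪ ⁅ e ⁆)
      1+r[Aᶜ]≡r[Aᶜ∪e] = +-cancelˡ-≡ (r A′) _ _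
        (trans (+-suc (r A′) (r Aᶜ)) (trans (cong (_+ r Aᶜ) (sym r[A′∪e]≡1+r[A′])) exchange))
      A′-drop : suc (r (E M ─ (A′ ∪ ⁅ e ⁆))) ≡ r (E M ─ A′)
      A′-drop = begin
        suc (r (E M ─ (A′ ∪ ⁅ e ⁆)))  ≡⟨ cong (λ U → suc (r (E M ─ U))) A′∪e≡A ⟩
        suc (r Aᶜ)                    ≡⟨ 1+r[Aᶜ]≡r[Aᶜ∪e] ⟩
        r (Aᶜ ∪ ⁅ e ⁆)                ≡⟨ cong r E─A′≡Aᶜ∪e ⟨
        r (E M ─ A′)                  ∎
        where open ≡-Reasoning
      Aᶜ-drop : suc (r (E M ─ (Aᶜ ∪ ⁅ e ⁆))) ≡ r (E M ─ Aᶜ)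
      Aᶜ-drop = begin
        suc (r (E M ─ (Aᶜ ∪ ⁅ e ⁆)))  ≡⟨ cong (λ U → suc (r (E M ─ U))) E─A′≡Aᶜ∪e ⟨
        suc (r (E M ─ (E M ─ A′)))    ≡⟨ cong (suc ∘ r) (p⊆q⇒q─[q─p]≡p A′⊆E) ⟩
        suc (r A′)                    ≡⟨ r[A′∪e]≡1+r[A′] ⟨
        r (A′ ∪ ⁅ e ⁆)                ≡⟨ cong r (trans A′∪e≡A (sym (p⊆q⇒q─[q─p]≡p A⊆E))) ⟩
        r (E M ─ Aᶜ)                  ∎
        where open ≡-Reasoning

-- Separations of order κ + 1

module STSeparations (M : MatroidData n) (isM : IsMatroid M) {S T : Subset n}
  (S⊆E : S ⊆ E M) (T⊆E : T ⊆ E M) (S∩T-empty : Empty (S ∩ T)) where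

  κ : ℕ
  κ = kappa M S T

  Sep : Subset n → Set
  Sep = STSeparating M S T κ

  private
    variable
      A B : Subset n
      e f g : Fin n

  sep? : ∀ A → Dec (Sep A)
  sep? A = (A ⊆? E M) ×-dec (S ⊆? A) ×-dec (T ⊆? E M ─ A) ×-dec (conn M A ≟ κ)

  sep⇒⊆E─T : Sep A → A ⊆ E M ─ T
  sep⇒⊆E─T (A⊆E , _ , T⊆E─A , _) x∈A = x∈p∧x∉q⇒x∈p─q (A⊆E x∈A) λ x∈T → proj₂ (x∈p─q⁻ (T⊆E─A x∈T)) x∈A

  sep-intro : S ⊆ A → A ⊆ E M ─ T → conn M A ≤ κ → Sep A
  sep-intro S⊆A A⊆E─T conn≤κ =
    proj₁ ∘ x∈p─q⁻ ∘ A⊆E─T , S⊆A ,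
    (λ x∈T → x∈p∧x∉q⇒x∈p─q (T⊆E x∈T) λ x∈A → proj₂ (x∈p─q⁻ (A⊆E─T x∈A)) x∈T) ,
    ≤-antisym conn≤κ (kappa≤conn M S T S⊆A A⊆E─T)

  sep-∪∩ : Sep A → Sep B → Sep (A ∪ B) × Sep (A ∩ B)
  sep-∪∩ {A} {B} sepA@(A⊆E , S⊆A , _ , connA≡κ) sepB@(B⊆E , S⊆B , _ , connB≡κ) =
    sep-intro S⊆A∪B A∪B⊆E─T (≤-reflexive conn∪≡κ) , sep-intro S⊆A∩B A∩B⊆E─T (≤-reflexive conn∩≡κ)
    where
    S⊆A∪B : S ⊆ A ∪ B
    S⊆A∪B = x∈p∪q⁺ ∘ inj₁ ∘ S⊆A
    S⊆A∩B : S ⊆ A ∩ B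
    S⊆A∩B x∈S = x∈p∩q⁺ (S⊆A x∈S , S⊆B x∈S)
    A∪B⊆E─T : A ∪ B ⊆ E M ─ T
    A∪B⊆E─T = ∪-lub (sep⇒⊆E─T sepA) (sep⇒⊆E─T sepB)
    A∩B⊆E─T : A ∩ B ⊆ E M ─ T
    A∩B⊆E─T = sep⇒⊆E─T sepA ∘ proj₁ ∘ x∈p∩q⁻ A B
    conn∪∩≡κ : conn M (A ∪ B) ≡ κ × conn M (A ∩ B) ≡ κ
    conn∪∩≡κ = +-squeeze
      (subst₂ (λ a b → conn M (A ∪ B) + conn M (A ∩ B) ≤ a + b) connA≡κ connB≡κ (conn-submodular M isM A⊆E B⊆E))
      (kappa≤conn M S T S⊆A∪B A∪B⊆E─T)
      (kappa≤conn M S T S⊆A∩B A∩B⊆E─T)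
    conn∪≡κ = proj₁ conn∪∩≡κ
    conn∩≡κ = proj₂ conn∪∩≡κ

  sep-conn : Sep A → conn M A ≡ κ
  sep-conn (_ , _ , _ , connA≡κ) = connA≡κ

  sep-⋃ : ∀ {ps} → A ∈ₗ ps → All Sep ps → Sep (⋃ ps)
  sep-⋃ = ⋃-preserves (λ sepB sepC → proj₁ (sep-∪∩ sepB sepC))

  SeparationStep : Fin n → Set
  SeparationStep e = ∃[ W ] (Sep W × Sep (W - e) × e ∈ W)

  S⊆E─T : S ⊆ E M ─ T
  S⊆E─T x∈S = x∈p∧x∉q⇒x∈p─q (S⊆E x∈S) λ x∈T → S∩T-empty (_ , x∈p∩q⁺ (x∈S , x∈T))

  module _ (e∈E─S∪T : e ∈ E M ─ (S ∪ T)) (ρ : Subset n → ℕ) where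

    open OneElementMinor M (proj₁ (x∈p─q⁻ e∈E─S∪T)) ρ

    private
      e∉S∪T = proj₂ (x∈p─q⁻ e∈E─S∪T)

      S⊆X⇒S⊆X-e : ∀ {X} → S ⊆ X → S ⊆ X - e
      S⊆X⇒S⊆X-e S⊆X x∈S = x∈p∧x≢y⇒x∈p-y (S⊆X x∈S) λ { refl → e∉S∪T (x∈p∪q⁺ (inj₁ x∈S)) }

      X⊆E─T⇒X-e⊆E-e─T : ∀ {X} → X ⊆ E M ─ T → X - e ⊆ E M - e ─ T
      X⊆E─T⇒X-e⊆E-e─T {X} X⊆E─T = subst (X - e ⊆_) (p─q─r≡p─r─q (E M) T ⁅ e ⁆) (─-monoˡ X⊆E─T)

    kappa-minor≤κ : (∀ {X} → X ⊆ E M → e ∈ X → conn N (X - e) ≤ conn M X) → kappa N S T ≤ κ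
    kappa-minor≤κ shrink with kappa-attained M S T S⊆E─T
    ... | X , S⊆X , X⊆E─T , connX≡κ = begin
      kappa N S T     ≤⟨ kappa≤conn N S T (S⊆X⇒S⊆X-e S⊆X) (X⊆E─T⇒X-e⊆E-e─T X⊆E─T) ⟩
      conn N (X - e)  ≤⟨ conn-shrink shrink (proj₁ ∘ x∈p─q⁻ ∘ X⊆E─T) ⟩
      conn M X        ≡⟨ connX≡κ ⟩
      κ               ∎
      where open ≤-Reasoning

    kappa-minor<κ⇒step : (∀ {Y} → Y ⊆ E M - e → conn M (Y ∪ ⁅ e ⁆) ≤ suc (conn N Y)) →
                         kappa N S T < κ → SeparationStep e
    kappa-minor<κ⇒step grow κN<κ with kappa-attained N S T (X⊆E─T⇒X-e⊆E-e─T S⊆E─T ∘ S⊆X⇒S⊆X-e ⊆-refl)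
    ... | Y , S⊆Y , Y⊆E-e─T , connY≡κN =
      Y ∪ ⁅ e ⁆ ,
      sep-intro (x∈p∪q⁺ ∘ inj₁ ∘ S⊆Y) (∪-lub Y⊆E─T (⁅x⁆⊆p e∈E─T)) (≤-trans (grow Y⊆E-e) 1+connY≤κ) ,
      subst Sep (sym (x∉p⇒[p∪⁅x⁆]-x≡p e∉Y)) (sep-intro S⊆Y Y⊆E─T (≤-trans (conn-grow grow Y⊆E-e) 1+connY≤κ)) ,
      x∈p∪q⁺ (inj₂ (x∈⁅x⁆ e))
      where
      e∈E─T : e ∈ E M ─ T
      e∈E─T = x∈p∧x∉q⇒x∈p─q (proj₁ (x∈p─q⁻ e∈E─S∪T)) (e∉S∪T ∘ x∈p∪q⁺ ∘ inj₂)
      Y⊆E-e : Y ⊆ E M - e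
      Y⊆E-e = proj₁ ∘ x∈p─q⁻ ∘ Y⊆E-e─T
      Y⊆E─T : Y ⊆ E M ─ T
      Y⊆E─T = ─-monoˡ (p─q⊆p (E M) ⁅ e ⁆) ∘ Y⊆E-e─T
      e∉Y : e ∉ Y
      e∉Y e∈Y = proj₂ (x∈p-y⁻ (Y⊆E-e e∈Y)) refl
      1+connY≤κ : suc (conn N Y) ≤ κ
      1+connY≤κ = subst (λ c → suc c ≤ κ) (sym connY≡κN) κN<κ

    kappa-minor≢κ⇒step :
      (∀ {X} → X ⊆ E M → e ∈ X → conn N (X - e) ≤ conn M X) →
      (∀ {Y} → Y ⊆ E M - e → conn M (Y ∪ ⁅ e ⁆) ≤ suc (conn N Y)) →
      kappa N S T ≢ κ → SeparationStep e
    kappa-minor≢κ⇒step shrink grow κN≢κ = kappa-minor<κ⇒step grow (≤∧≢⇒< (kappa-minor≤κ shrink) κN≢κ)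

  nonflexible⇒step : e ∈ E M ─ (S ∪ T) → ¬ Flexible M S T e → SeparationStep e
  nonflexible⇒step {e} e∈E─S∪T ¬flexible with kappa (delete M e) S T ≟ κ | kappa (contract M e) S T ≟ κ
  ... | no κ[M\e]≢κ | _ = kappa-minor≢κ⇒step e∈E─S∪T (rk (delete M e))
    (conn-delete-shrink M isM) (conn-delete-grow M isM (proj₁ (x∈p─q⁻ e∈E─S∪T))) κ[M\e]≢κ
  ... | yes _ | no κ[M/e]≢κ = kappa-minor≢κ⇒step e∈E─S∪T (rk (contract M e))
    (conn-contract-shrink M isM) (conn-contract-grow M isM (proj₁ (x∈p─q⁻ e∈E─S∪T))) κ[M/e]≢κ
  ... | yes deletable | yes contractible = contradiction (e∈E─S∪T , deletable , contractible) ¬flexible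

  module MinSep (e : Fin n) = LeastMember (λ A → sep? A ×-dec (e ∈? A))
    (λ (sepA , e∈A) (sepB , e∈B) → proj₂ (sep-∪∩ sepA sepB) , x∈p∩q⁺ (e∈A , e∈B))

  minSep : Fin n → Subset n
  minSep = MinSep.least

  minSep⊆ : Sep A → e ∈ A → minSep e ⊆ A
  minSep⊆ sepA e∈A = MinSep.least⊆ _ (sepA , e∈A)

  step⇒sep-minSep : SeparationStep e → Sep (minSep e) × e ∈ minSep e
  step⇒sep-minSep (W , sepW , _ , e∈W) = MinSep.P-least _ (sepW , e∈W)

  step⇒sep-minSep-e : SeparationStep e → Sep (minSep e - e)
  step⇒sep-minSep-e step@(W , sepW , sepW-e , e∈W) =
    subst Sep (p⊆q⇒p∩[q-x]≡p-x (minSep⊆ sepW e∈W)) (proj₂ (sep-∪∩ (proj₁ (step⇒sep-minSep step)) sepW-e))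

  -- g ∈ minSep f would give minSep g ⊆ minSep f - f, which misses f.
  minSep-strict : SeparationStep f → SeparationStep g → f ∈ minSep g → f ≢ g → ∣ minSep f ∣ < ∣ minSep g ∣
  minSep-strict stepf stepg f∈Dg f≢g = p⊂q⇒∣p∣<∣q∣
    ( minSep⊆ (proj₁ (step⇒sep-minSep stepg)) f∈Dg
    , _ , proj₂ (step⇒sep-minSep stepg)
    , λ g∈Df → proj₂ (x∈p-y⁻ (minSep⊆ (step⇒sep-minSep-e stepf) (x∈p∧x≢y⇒x∈p-y g∈Df (f≢g ∘ sym)) f∈Dg)) refl )

-- Ordering the elements of F

module Construction (M : MatroidData n) (isM : IsMatroid M) {S T F : Subset n}
  (S⊆E : S ⊆ E M) (T⊆E : T ⊆ E M) (S∩T-empty : Empty (S ∩ T))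
  (F⊆E─S∪T : F ⊆ E M ─ (S ∪ T)) (¬flexible : ∀ e → e ∈ F → ¬ Flexible M S T e) where

  open STSeparations M isM S⊆E T⊆E S∩T-empty
  open SortedEnumeration (sortedEnumeration (λ e → ∣ minSep e ∣) ∣ F ∣ F refl) public
    renaming (enum to f)

  private
    variable
      i j l : Fin ∣ F ∣

  step : ∀ i → SeparationStep (f i)
  step i = nonflexible⇒step (F⊆E─S∪T (enum∈F i)) (¬flexible _ (enum∈F i))

  index-≤ : f l ∈ minSep (f j) → toℕ l ≤ toℕ j
  index-≤ {l} {j} fl∈Dfj with l Fin.≟ j
  ... | yes refl = ≤-refl
  ... | no l≢j = ≮⇒≥ λ j<l →
    <⇒≱ (minSep-strict (step l) (step j) fl∈Dfj (l≢j ∘ injective)) (sorted j l (<⇒≤ j<l))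

  upTo : Fin ∣ F ∣ → List (Fin ∣ F ∣)
  upTo i = filter (λ j → toℕ j ≤? toℕ i) (allFin ∣ F ∣)

  ∈upTo⁺ : toℕ j ≤ toℕ i → j ∈ₗ upTo i
  ∈upTo⁺ {j} j≤i = ∈-filter⁺ (λ j → toℕ j ≤? _) (∈-allFin j) j≤i

  ∈upTo⁻ : j ∈ₗ upTo i → toℕ j ≤ toℕ i
  ∈upTo⁻ {i = i} j∈upTo = proj₂ (∈-filter⁻ (λ j → toℕ j ≤? toℕ i) {xs = allFin ∣ F ∣} j∈upTo)

  A : Fin ∣ F ∣ → Subset n
  A i = ⋃ (map (minSep ∘ f) (upTo i))

  x∈A⁺ : toℕ j ≤ toℕ i → x ∈ minSep (f j) → x ∈ A i
  x∈A⁺ j≤i x∈Dfj = x∈⋃⁺ (Any-map⁺ (lose (∈upTo⁺ j≤i) x∈Dfj))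

  x∈A⁻ : x ∈ A i → ∃[ j ] (toℕ j ≤ toℕ i × x ∈ minSep (f j))
  x∈A⁻ {i = i} x∈Ai =
    let j , j∈upTo , x∈Dfj = find (Any-map⁻ (x∈⋃⁻ (map (minSep ∘ f) (upTo i)) x∈Ai))
    in j , ∈upTo⁻ j∈upTo , x∈Dfj

  fi∈Ai : ∀ i → f i ∈ A i
  fi∈Ai i = x∈A⁺ ≤-refl (proj₂ (step⇒sep-minSep (step i)))

  A-sep : ∀ i → Sep (A i)
  A-sep i = sep-⋃ (∈-map⁺ (minSep ∘ f) (∈upTo⁺ ≤-refl))
    (All-map⁺ (All.tabulate λ {j} _ → proj₁ (step⇒sep-minSep (step j))))

  A-fi-sep : ∀ i → Sep (A i - f i)
  A-fi-sep i = subst Sep (sym (⋃-map-─ (minSep ∘ f) (upTo i) ⁅ f i ⁆))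
    (sep-⋃ (∈-map⁺ (λ j → minSep (f j) - f i) (∈upTo⁺ ≤-refl)) (All-map⁺ (All.tabulate sep-Dfj-fi)))
    where
    sep-Dfj-fi : ∀ {j} → j ∈ₗ upTo i → Sep (minSep (f j) - f i)
    sep-Dfj-fi {j} j∈upTo with j Fin.≟ i
    ... | yes refl = step⇒sep-minSep-e (step i)
    ... | no j≢i = subst Sep (sym (x∉p⇒p-x≡p fi∉Dfj)) (proj₁ (step⇒sep-minSep (step j)))
      where
      fi∉Dfj : f i ∉ minSep (f j)
      fi∉Dfj fi∈Dfj = j≢i (toℕ-injective (≤-antisym (∈upTo⁻ j∈upTo) (index-≤ fi∈Dfj)))

  A-mono : ∀ i j → toℕ j ≡ suc (toℕ i) → A i ⊆ A j
  A-mono i j j≡1+i x∈Ai =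
    let k , k≤i , x∈Dfk = x∈A⁻ x∈Ai in x∈A⁺ (≤-trans k≤i (≤-trans (n≤1+n _) (≤-reflexive (sym j≡1+i)))) x∈Dfk

  A∩F : ∀ i x → (x ∈ A i ∩ F) ⇔ (∃[ j ] (toℕ j ≤ toℕ i × f j ≡ x))
  A∩F i x = mk⇔ to λ { (j , j≤i , refl) → x∈p∩q⁺ (x∈A⁺ j≤i (proj₂ (step⇒sep-minSep (step j))) , enum∈F j) }
    where
    to : x ∈ A i ∩ F → ∃[ j ] (toℕ j ≤ toℕ i × f j ≡ x)
    to x∈Ai∩F with x∈p∩q⁻ (A i) F x∈Ai∩F
    ... | x∈Ai , x∈F with x∈A⁻ x∈Ai | Equivalence.to (image x) x∈F
    ...   | j , j≤i , x∈Dfj | l , refl = l , ≤-trans (index-≤ x∈Dfj) j≤i , refl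

  guts⊎coguts : ∀ i → (InCl M (A i - f i) (f i) × InCl M (E M ─ A i) (f i))
                      ⊎ (InCoCl M (A i - f i) (f i) × InCoCl M (E M ─ A i) (f i))
  guts⊎coguts i = conn[A-e]≡conn[A]⇒guts⊎coguts M isM (proj₁ (A-sep i)) (fi∈Ai i)
    (trans (sep-conn (A-fi-sep i)) (sym (sep-conn (A-sep i))))

theorem3p4 : ∀ {n} (M : MatroidData n) → IsMatroid M →
    (S T F : Subset n) → S ⊆ E M → T ⊆ E M → Empty (S ∩ T) →
    F ⊆ (E M ─ (S ∪ T)) → (∀ e → e ∈ F → ¬ Flexible M S T e) →
    Σ (Fin ∣ F ∣ → Fin n) λ f → Σ (Fin ∣ F ∣ → Subset n) λ A →
      Injective _≡_ _≡_ f
      × (∀ x → x ∈ F ⇔ (∃[ i ] f i ≡ x))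
      × (∀ i → STSeparating M S T (kappa M S T) (A i))
      × (∀ i j → toℕ j ≡ suc (toℕ i) → A i ⊆ A j)
      × (∀ i x → (x ∈ (A i ∩ F)) ⇔ (∃[ j ] (toℕ j ≤ toℕ i × f j ≡ x)))
      × (∀ i → (InCl M (A i - f i) (f i) × InCl M (E M ─ A i) (f i))
               ⊎ (InCoCl M (A i - f i) (f i) × InCoCl M (E M ─ A i) (f i)))
theorem3p4 M isM S T F S⊆E T⊆E S∩T-empty F⊆E─S∪T ¬flexible =
  f , A , injective , image , A-sep , A-mono , A∩F , guts⊎coguts
  where open Construction M isM S⊆E T⊆E S∩T-empty F⊆E─S∪T ¬flexible
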